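{- Let $U\subseteq\mathbb Z$ be infinite. Suppose $f\in LIP(U)$ and $f(x)=0$ for infinitely many $x\in U$. Then $f(x)=0$ for all $x\in U$.
   Context: For an infinite $U\subseteq\mathbb Z$, a function $f\colon U\to\mathbb Z$ is LIP on $U$ if for every finite $X\subseteq U$ there is $p\in\mathbb Z[x]$ with $p(x)=f(x)$ for all $x\in X$; $LIP(U)$ is the set of all such functions. -}

module Defs where

open import Data.Integer using (ℤ; _+_; _*_; 0ℤ)
open import Data.List using (List; []; _∷_)
open import Data.List.Relation.Unary.All using (All)
open import Data.List.Membership.Propositional using (_∈_)
open import Data.Product using (Σ; ∃; _×_)
open import Relation.Nullary using (¬_)
open import Relation.Binary.PropositionalEquality using (_≡_)

-- A polynomial in ℤ[x], given by its coefficient list (constant term first).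
Poly : Set
Poly = List ℤ

eval : Poly → ℤ → ℤ
eval []       x = 0ℤ
eval (a ∷ as) x = a + x * eval as x

-- A subset of ℤ is a predicate; P ⊆ ℤ is infinite if it is not
-- exhausted by any finite list: every finite list misses some element of P.
Infinite : (ℤ → Set) → Set
Infinite P = (xs : List ℤ) → ∃ λ x → P x × ¬ (x ∈ xs)

LIP : (U : ℤ → Set) → (ℤ → ℤ) → Set
LIP U f = (X : List ℤ) → All U X → Σ Poly λ p → All (λ x → eval p x ≡ f x) X

-- Given x ∈ U, pick a zero z of f in U with ∣x − z∣ > ∣f x∣ and a polynomial p
-- agreeing with f at x and z. Then x − z divides p(x) − p(z) = f x, which is
-- smaller in absolute value than x − z, so f x = 0.
module Submission where

open import Defs
open import Data.Integer using (ℤ; 0ℤ; +_; -[1+_]; _+_; _*_; _-_; ∣_∣)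
open import Data.Integer.Divisibility.Signed
  using (_∣_; divides; ∣-refl; ∣m∣n⇒∣m+n; ∣n⇒∣m*n; ∣m⇒∣m*n; ∣⇒∣ᵤ)
open import Data.Integer.Properties using (∣i∣≡0⇒i≡0; +-identityʳ)
open import Data.Integer.Tactic.RingSolver using (solve-∀)
open import Data.Nat as ℕ using (ℕ; zero; suc)
import Data.Nat.Divisibility as ℕ
open import Data.Nat.Properties using (n≤0⇒n≡0; m≤n⇒m<n∨m≡n; ≰⇒>)
open import Data.Product using (_×_; _,_; ∃)
open import Data.Sum using (inj₁; inj₂)
open import Data.List using (List; []; _∷_; map)
open import Data.List.Relation.Unary.All using ([]; _∷_)
open import Data.List.Relation.Unary.Any using (here; there)
open import Data.List.Membership.Propositional using (_∈_)
open import Data.List.Membership.Propositional.Properties using (∈-map⁺)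
open import Relation.Nullary using (contradiction)
open import Relation.Binary.PropositionalEquality
  using (_≡_; refl; sym; trans; cong₂; subst)

eval-sub-∣ : ∀ p a b → a - b ∣ eval p a - eval p b
eval-sub-∣ []       a b = divides 0ℤ refl
eval-sub-∣ (c ∷ cs) a b = subst (a - b ∣_) (sym (split c a b (eval cs a) (eval cs b)))
  (∣m∣n⇒∣m+n (∣n⇒∣m*n a (eval-sub-∣ cs a b)) (∣m⇒∣m*n (eval cs b) ∣-refl))
  where
  split : ∀ c a b A B → (c + a * A) - (c + b * B) ≡ a * (A - B) + (a - b) * B
  split = solve-∀

n<m∧m∣n⇒n≡0 : ∀ {m n} → n ℕ.< m → m ℕ.∣ n → n ≡ 0
n<m∧m∣n⇒n≡0 {n = zero}  _   _   = refl
n<m∧m∣n⇒n≡0 {n = suc _} n<m m∣n = contradiction m∣n (ℕ.>⇒∤ n<m)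

∣j∣<∣i∣∧i∣j⇒j≡0 : ∀ {i j} → ∣ j ∣ ℕ.< ∣ i ∣ → i ∣ j → j ≡ 0ℤ
∣j∣<∣i∣∧i∣j⇒j≡0 ∣j∣<∣i∣ i∣j = ∣i∣≡0⇒i≡0 (n<m∧m∣n⇒n≡0 ∣j∣<∣i∣ (∣⇒∣ᵤ i∣j))

interval : ℕ → List ℤ
interval zero    = 0ℤ ∷ []
interval (suc n) = + suc n ∷ -[1+ n ] ∷ interval n

∈-interval : ∀ {i n} → ∣ i ∣ ℕ.≤ n → i ∈ interval n
∈-interval {i} {zero} ∣i∣≤0 = here (∣i∣≡0⇒i≡0 (n≤0⇒n≡0 ∣i∣≤0))
∈-interval {i} {suc n} ∣i∣≤1+n with m≤n⇒m<n∨m≡n ∣i∣≤1+n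
∈-interval {i}         {suc n} _ | inj₁ ∣i∣<1+n = there (there (∈-interval (ℕ.s≤s⁻¹ ∣i∣<1+n)))
∈-interval {+ _}       {suc n} _ | inj₂ refl   = here refl
∈-interval { -[1+ _ ]} {suc n} _ | inj₂ refl   = there (here refl)

ball : ℤ → ℕ → List ℤ
ball x n = map (x -_) (interval n)

∈-ball : ∀ {x z n} → ∣ x - z ∣ ℕ.≤ n → z ∈ ball x n
∈-ball {x} {z} ∣x-z∣≤n = subst (_∈ ball x _) (cancel x z) (∈-map⁺ (x -_) (∈-interval ∣x-z∣≤n))
  where
  cancel : ∀ x z → x - (x - z) ≡ z
  cancel = solve-∀

Infinite⇒far : ∀ {P} → Infinite P → ∀ x n → ∃ λ z → P z × n ℕ.< ∣ x - z ∣
Infinite⇒far inf x n with inf (ball x n)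
... | z , Pz , z∉ball = z , Pz , ≰⇒> (λ ∣x-z∣≤n → z∉ball (∈-ball {x} ∣x-z∣≤n))

lemma3 : (U : ℤ → Set) → Infinite U → (f : ℤ → ℤ) → LIP U f →
         Infinite (λ x → U x × f x ≡ 0ℤ) →
         (x : ℤ) → U x → f x ≡ 0ℤ
lemma3 U _ f lip zeros x Ux with Infinite⇒far zeros x ∣ f x ∣
... | z , (Uz , fz≡0) , ∣fx∣<∣x-z∣ with lip (x ∷ z ∷ []) (Ux ∷ Uz ∷ [])
... | p , (px≡fx ∷ pz≡fz ∷ []) = ∣j∣<∣i∣∧i∣j⇒j≡0 ∣fx∣<∣x-z∣ x-z∣fx
  where
  px-pz≡fx : eval p x - eval p z ≡ f x
  px-pz≡fx = trans (cong₂ _-_ px≡fx (trans pz≡fz fz≡0)) (+-identityʳ (f x))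

  x-z∣fx : x - z ∣ f x
  x-z∣fx = subst (x - z ∣_) px-pz≡fx (eval-sub-∣ p x z)
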